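{- Let $X=X_0\cup\dots\cup X_d$ (with $X_0=\{x\}$) and the pattern set $Y$ be finite, let $L=L(X|Y)$, let $D=\max\{\mathrm{height}(t): t\in Y\}$ ($D=0$ if $Y=\emptyset$), and let $L_D$ be the set of trees in $L$ of height at most $D$. For $t\in L$ put $\widehat{M_t}=\{v\in L: t\sqsubseteq v\}$ and $M_t=\widehat{M_t}\setminus\bigcup_{s\in L_D,\ t\sqsubset s}\widehat{M_s}$. Then $L$ is the disjoint union of the sets $M_t$, $t\in L_D$.
   Context: Labelled trees: planar rooted trees whose vertices other than the root carry labels from a finite set $X=X_0\cup\dots\cup X_d$ ($d>0$), where $X_i$ is the set of labels of vertices having exactly $i$ children; $X_0=\{x\}$ and vertices labelled $x$ are leaves called free ends; other non-root vertices are internal nodes. Grafting a tree $s$ onto a free end of a tree $t$ means identifying the root edge of $s$ with that free end. A tree avoids a set $Y$ of patterns if it contains no subtree isomorphic to an element of $Y$; $L(X|Y)$ is the set of trees avoiding $Y$ (identified with their Polish-notation words over $X$). The height of a tree is the maximal number of internal nodes lying on one branch (root-to-leaf path). A tree $t$ is a rooted subtree of $v$, written $t\sqsubseteq v$, if $v$ can be obtained from $t$ by grafting other trees onto free ends of $t$; $t\sqsubset v$ means $t\sqsubseteq v$ and $t\ne v$. The tree consisting of the root and a single free end (word $x$) has height $0$. -}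

module Defs where

open import Data.Nat using (ℕ; zero; suc; _≤_; _⊔_)
open import Data.Fin using (Fin)
open import Data.Vec using (Vec; []; _∷_; lookup)
open import Data.List using (List; foldr; map)
open import Data.List.Membership.Propositional using (_∈_)
open import Data.Product using (_×_; ∃)
open import Relation.Nullary using (¬_)
open import Relation.Binary.PropositionalEquality using (_≡_; _≢_)

-- A finite graded label set X = X_0 ∪ X_1 ∪ … ∪ X_d with X_0 = {x}.
-- The internal labels (X_1 ∪ … ∪ X_d) are the elements of Fin labels,
-- `arity a` is the number of children of a vertex labelled a (a ∈ X_{arity a}).
-- The free-end label x is represented by the constructor `leaf` below.
record Signature : Set where
  field
    labels   : ℕ
    arity    : Fin labels → ℕ
    arity≥1  : ∀ a → 1 ≤ arity a

module _ (Σ : Signature) where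
  open Signature Σ

  -- Planar rooted labelled trees.  `leaf` is the tree "root + one free end"
  -- (Polish word x); `node a ts` is the root edge attached to a vertex
  -- labelled a whose children (in planar order) are the trees ts.
  data Tree : Set where
    leaf : Tree
    node : (a : Fin labels) → Vec Tree (arity a) → Tree

  mutual
    height : Tree → ℕ
    height leaf        = 0
    height (node a ts) = suc (heights ts)

    heights : ∀ {k} → Vec Tree k → ℕ
    heights []       = 0
    heights (t ∷ ts) = height t ⊔ heights ts

  -- Rooted subtree: t ⊑ v iff v is obtained from t by grafting trees
  -- onto free ends of t.
  data _⊑_ : Tree → Tree → Set where
    leaf⊑ : ∀ {v} → leaf ⊑ v
    node⊑ : ∀ {a ts vs} → (∀ i → lookup ts i ⊑ lookup vs i) → node a ts ⊑ node a vs

  _⊏_ : Tree → Tree → Set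
  t ⊏ v = t ⊑ v × t ≢ v

  -- Pattern p occurs in t (t contains a subtree isomorphic to p):
  -- p is a rooted subtree of the subtree of t hanging at some vertex/edge.
  data Occurs (p : Tree) : Tree → Set where
    here  : ∀ {t} → p ⊑ t → Occurs p t
    there : ∀ {a ts} (i : Fin (arity a)) → Occurs p (lookup ts i) → Occurs p (node a ts)

  InL : List Tree → Tree → Set
  InL Y t = ∀ {p} → p ∈ Y → ¬ Occurs p t

  maxHeight : List Tree → ℕ
  maxHeight Y = foldr _⊔_ 0 (map height Y)

  InLD : List Tree → Tree → Set
  InLD Y t = InL Y t × height t ≤ maxHeight Y

  InMhat : List Tree → Tree → Tree → Set
  InMhat Y t v = InL Y v × t ⊑ v

  InM : List Tree → Tree → Tree → Set
  InM Y t v = InMhat Y t v × ¬ (∃ λ s → InLD Y s × t ⊏ s × InMhat Y s v)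

{-# OPTIONS --safe #-}
-- Let D be the maximal height of a pattern and cut every tree v off at depth D.
-- The cut tree ⌊v⌋ is the largest rooted subtree of v of height at most D, and
-- since avoiding Y is inherited by rooted subtrees, ⌊v⌋ ∈ L_D whenever v ∈ L.
-- Hence v lies in M_⌊v⌋, and in no other M_t with t ∈ L_D: such a t satisfies
-- t ⊑ ⌊v⌋, so t ≠ ⌊v⌋ would make v an element of M̂_⌊v⌋ with t ⊏ ⌊v⌋ ∈ L_D.
module Submission where

open import Defs
open import Data.List using (List)
open import Data.Product using (_×_; ∃; _,_; proj₁)
open import Relation.Binary.PropositionalEquality using (_≡_; refl; sym; trans; cong; module ≡-Reasoning)
open import Data.Nat using (ℕ; zero; suc; _≤_; z≤n; s≤s)
open import Data.Nat.Properties using (⊔-lub; m≤m⊔n; m≤n⊔m; ≤-trans)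
open import Data.Fin using (Fin; zero; suc)
import Data.Fin.Properties as Fin
open import Data.Vec using (Vec; []; _∷_; lookup; tabulate)
open import Data.Vec.Properties using (tabulate∘lookup; tabulate-cong)
open import Relation.Nullary using (Dec; yes; no)
open import Data.Empty using (⊥-elim)

module _ (Σ : Signature) where

  mutual
    trunc : ℕ → Tree Σ → Tree Σ
    trunc zero    t           = leaf
    trunc (suc n) leaf        = leaf
    trunc (suc n) (node a ts) = node a (truncs n ts)

    truncs : ∀ {k} → ℕ → Vec (Tree Σ) k → Vec (Tree Σ) k
    truncs n []       = []
    truncs n (t ∷ ts) = trunc n t ∷ truncs n ts

  mutual
    height-trunc : ∀ n t → height Σ (trunc n t) ≤ n
    height-trunc zero    t           = z≤n
    height-trunc (suc n) leaf        = z≤n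
    height-trunc (suc n) (node a ts) = s≤s (heights-truncs n ts)

    heights-truncs : ∀ {k} n (ts : Vec (Tree Σ) k) → heights Σ (truncs n ts) ≤ n
    heights-truncs n []       = z≤n
    heights-truncs n (t ∷ ts) = ⊔-lub (height-trunc n t) (heights-truncs n ts)

  mutual
    trunc-⊑ : ∀ n t → _⊑_ Σ (trunc n t) t
    trunc-⊑ zero    t           = leaf⊑
    trunc-⊑ (suc n) leaf        = leaf⊑
    trunc-⊑ (suc n) (node a ts) = node⊑ (truncs-⊑ n ts)

    truncs-⊑ : ∀ {k} n (ts : Vec (Tree Σ) k) (i : Fin k) →
               _⊑_ Σ (lookup (truncs n ts) i) (lookup ts i)
    truncs-⊑ n (t ∷ ts) zero    = trunc-⊑ n t
    truncs-⊑ n (t ∷ ts) (suc i) = truncs-⊑ n ts i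

  mutual
    ⊑-trunc : ∀ n {s v} → _⊑_ Σ s v → height Σ s ≤ n → _⊑_ Σ s (trunc n v)
    ⊑-trunc n       leaf⊑     _       = leaf⊑
    ⊑-trunc (suc n) (node⊑ {ts = ss} {vs} p) (s≤s h) = node⊑ (⊑-truncs n ss vs p h)

    ⊑-truncs : ∀ {k} n (ss vs : Vec (Tree Σ) k) →
               (∀ i → _⊑_ Σ (lookup ss i) (lookup vs i)) → heights Σ ss ≤ n →
               ∀ i → _⊑_ Σ (lookup ss i) (lookup (truncs n vs) i)
    ⊑-truncs n (s ∷ ss) (v ∷ vs) p h zero    = ⊑-trunc n (p zero) (≤-trans (m≤m⊔n _ _) h)
    ⊑-truncs n (s ∷ ss) (v ∷ vs) p h (suc i) =
      ⊑-truncs n ss vs (λ j → p (suc j)) (≤-trans (m≤n⊔m _ _) h) i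

  ⊑-trans : ∀ {s t u} → _⊑_ Σ s t → _⊑_ Σ t u → _⊑_ Σ s u
  ⊑-trans leaf⊑     _         = leaf⊑
  ⊑-trans (node⊑ p) (node⊑ q) = node⊑ (λ i → ⊑-trans (p i) (q i))

  ⊑-antisym : ∀ {s t} → _⊑_ Σ s t → _⊑_ Σ t s → s ≡ t
  ⊑-antisym leaf⊑ leaf⊑ = refl
  ⊑-antisym (node⊑ {a = a} {ts} {vs} p) (node⊑ q) = cong (node a) (begin
      ts                   ≡⟨ sym (tabulate∘lookup ts) ⟩
      tabulate (lookup ts) ≡⟨ tabulate-cong (λ i → ⊑-antisym (p i) (q i)) ⟩
      tabulate (lookup vs) ≡⟨ tabulate∘lookup vs ⟩
      vs                   ∎)
    where open ≡-Reasoning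

  mutual
    _≟_ : (s t : Tree Σ) → Dec (s ≡ t)
    leaf      ≟ leaf      = yes refl
    leaf      ≟ node _ _  = no λ ()
    node _ _  ≟ leaf      = no λ ()
    node a ss ≟ node b ts with a Fin.≟ b
    ... | no a≢b = no λ { refl → a≢b refl }
    ... | yes refl with ss ≟s ts
    ...   | yes refl  = yes refl
    ...   | no ss≢ts  = no λ { refl → ss≢ts refl }

    _≟s_ : ∀ {k} (ss ts : Vec (Tree Σ) k) → Dec (ss ≡ ts)
    []       ≟s []       = yes refl
    (s ∷ ss) ≟s (t ∷ ts) with s ≟ t | ss ≟s ts
    ... | yes refl | yes refl  = yes refl
    ... | no s≢t   | _         = no λ { refl → s≢t refl }
    ... | yes _    | no ss≢ts  = no λ { refl → ss≢ts refl }

  Occurs-⊑ : ∀ {p t v} → Occurs Σ p t → _⊑_ Σ t v → Occurs Σ p v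
  Occurs-⊑ (here q)    r         = here (⊑-trans q r)
  Occurs-⊑ (there i o) (node⊑ f) = there i (Occurs-⊑ o (f i))

  InL-⊑ : ∀ Y {t v} → InL Σ Y v → _⊑_ Σ t v → InL Σ Y t
  InL-⊑ Y v∈L t⊑v p∈Y o = v∈L p∈Y (Occurs-⊑ o t⊑v)

  module _ (Y : List (Tree Σ)) where
    private
      D : ℕ
      D = maxHeight Σ Y

    InLD-trunc : ∀ {v} → InL Σ Y v → InLD Σ Y (trunc D v)
    InLD-trunc {v} v∈L = InL-⊑ Y v∈L (trunc-⊑ D v) , height-trunc D v

    InM-trunc : ∀ {v} → InL Σ Y v → InM Σ Y (trunc D v) v
    InM-trunc {v} v∈L = (v∈L , trunc-⊑ D v) , λ where
      (s , (_ , hs) , (⌊v⌋⊑s , ⌊v⌋≢s) , (_ , s⊑v)) →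
        ⌊v⌋≢s (⊑-antisym ⌊v⌋⊑s (⊑-trunc D s⊑v hs))

    -- Maximality of t only refutes t ≢ ⌊v⌋; decidable equality turns that into t ≡ ⌊v⌋.
    InM⇒≡trunc : ∀ {t v} → InLD Σ Y t → InM Σ Y t v → t ≡ trunc D v
    InM⇒≡trunc {t} {v} (_ , ht) ((v∈L , t⊑v) , maximal) with t ≟ trunc D v
    ... | yes t≡⌊v⌋ = t≡⌊v⌋
    ... | no  t≢⌊v⌋ = ⊥-elim (maximal
      (trunc D v , InLD-trunc v∈L , (⊑-trunc D t⊑v ht , t≢⌊v⌋) , (v∈L , trunc-⊑ D v)))

lemma4p4 : (Σ : Signature) (Y : List (Tree Σ)) →
    -- every M_t (t ∈ L_D) is contained in L
    ((t v : Tree Σ) → InLD Σ Y t → InM Σ Y t v → InL Σ Y v)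
    -- L is covered by the sets M_t, t ∈ L_D
    × ((v : Tree Σ) → InL Σ Y v → ∃ λ t → InLD Σ Y t × InM Σ Y t v)
    -- the sets M_t, t ∈ L_D, are pairwise disjoint
    × ((t t′ v : Tree Σ) → InLD Σ Y t → InLD Σ Y t′ →
         InM Σ Y t v → InM Σ Y t′ v → t ≡ t′)
lemma4p4 Σ Y =
    (λ _ _ _ v∈M → proj₁ (proj₁ v∈M))
  , (λ v v∈L → trunc Σ D v , InLD-trunc Σ Y v∈L , InM-trunc Σ Y v∈L)
  , (λ _ _ _ t∈LD t′∈LD v∈Mt v∈Mt′ →
       trans (InM⇒≡trunc Σ Y t∈LD v∈Mt) (sym (InM⇒≡trunc Σ Y t′∈LD v∈Mt′)))
  where
  D : ℕ
  D = maxHeight Σ Y
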